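{- Let $k\ge5$ be odd, $\kappa=\lfloor k/3\rfloor$, $K=(k-1)/2$. For $1\le\ell\le K$ and $1\le m\le K-1$ let \[b_k(\ell,m)=\binom{2m}{2\ell-2}+\binom{2m}{k-2\ell}-\delta_{2\ell-1,2m+1},\] and let $\mathcal C_k=(b_k(\ell,m))_{1\le\ell\le K,\,1\le m\le K-1}$. For $\ell=1,\dots,\kappa$ set $n_\ell=\ell$ if $1\le\ell\le\lfloor\frac{\kappa+1}{2}\rfloor$ and $n_\ell=\ell+K-\kappa$ if $\lfloor\frac{\kappa+1}{2}\rfloor+1\le\ell\le\kappa$. Then the $\kappa\times\kappa$ matrix $\mathcal S_k=(b_k(n_\ell,m))_{1\le\ell\le\kappa,\,1\le m\le\kappa}$ (a submatrix of $\mathcal C_k$) has full rank $\kappa$; hence $\mathrm{rank}\,\mathcal C_k\ge\kappa$.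
   Context: Convention: $\binom{n}{m}=0$ unless the integers $n,m$ satisfy $n\ge m\ge0$; $\delta$ is the Kronecker delta. -}

module Defs where

open import Data.Nat as ℕ using (ℕ; zero; suc; _≤ᵇ_)
open import Data.Nat.DivMod using (_/_)
open import Data.Nat.Combinatorics using (_C_)
open import Data.Integer as ℤ using (ℤ; +_; -[1+_])
open import Data.Rational as ℚ using (ℚ)
open import Data.Fin using (Fin; toℕ)
open import Data.Bool using (if_then_else_)
open import Relation.Nullary using (yes; no)
open import Relation.Binary.PropositionalEquality using (_≡_)
open import Data.Product using (_×_) renaming (Σ to Σ′)
import Data.Fin as Fin

-- Binomial coefficient with the paper's convention:
-- binom n m = 0 unless the integers n, m satisfy n ≥ m ≥ 0.
-- (For naturals, stdlib's  n C m  is already 0 when m > n.)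
binom : ℤ → ℤ → ℤ
binom (+ n) (+ m) = + (n C m)
binom (+ n) -[1+ m ] = + 0
binom -[1+ n ] m = + 0

δ : ℤ → ℤ → ℤ
δ a b with a ℤ.≟ b
... | yes _ = + 1
... | no _ = + 0

κ : ℕ → ℕ
κ k = k / 3

K : ℕ → ℕ
K k = (k ℕ.∸ 1) / 2

b : ℕ → ℕ → ℕ → ℤ
b k ℓ m =
  binom (+ (2 ℕ.* m)) (+ (2 ℕ.* ℓ) ℤ.- + 2)
  ℤ.+ binom (+ (2 ℕ.* m)) (+ k ℤ.- + (2 ℕ.* ℓ))
  ℤ.- δ (+ (2 ℕ.* ℓ) ℤ.- + 1) (+ (2 ℕ.* m) ℤ.+ + 1)

nIdx : ℕ → ℕ → ℕ
nIdx k ℓ = if ℓ ≤ᵇ ((κ k ℕ.+ 1) / 2) then ℓ else ℓ ℕ.+ K k ℕ.∸ κ k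

toℚ : ℤ → ℚ
toℚ z = z ℚ./ 1

-- 𝒞_k as a K × (K-1) matrix, 0-based Fin indices ↦ 1-based ℓ, m
𝒞 : (k : ℕ) → Fin (K k) → Fin (K k ℕ.∸ 1) → ℚ
𝒞 k ℓ m = toℚ (b k (suc (toℕ ℓ)) (suc (toℕ m)))

𝒮 : (k : ℕ) → Fin (κ k) → Fin (κ k) → ℚ
𝒮 k ℓ m = toℚ (b k (nIdx k (suc (toℕ ℓ))) (suc (toℕ m)))

Σ : (n : ℕ) → (Fin n → ℚ) → ℚ
Σ zero f = ℚ.0ℚ
Σ (suc n) f = f Fin.zero ℚ.+ Σ n (λ i → f (Fin.suc i))

-- A p×q matrix over ℚ has rank p (rows linearly independent over ℚ):
-- every ℚ-linear combination of rows that vanishes has all coefficients 0.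
RowsIndependent : (p q : ℕ) → (Fin p → Fin q → ℚ) → Set
RowsIndependent p q A =
  (y : Fin p → ℚ) → (∀ j → Σ p (λ i → y i ℚ.* A i j) ≡ ℚ.0ℚ) → ∀ i → y i ≡ ℚ.0ℚ

-- Rank ≥ r (over ℚ): some r rows, chosen by an injective index map, are independent.
RankAtLeast : (r p q : ℕ) → (Fin p → Fin q → ℚ) → Set
RankAtLeast r p q A =
  Σ′ (Fin r → Fin p) λ σ → (∀ i j → σ i ≡ σ j → i ≡ j) × RowsIndependent r q (λ i j → A (σ i) j)

module Submission where

-- Put w = t + t² and let F_n(w) be the Fibonacci polynomials, F₀ = 0, F₁ = 1,
-- F_{n+2} = F_{n+1} + w F_n.  As 1 + t and −t are the roots of x² = x + w,
-- (1 + t)ⁿ = (1 + 2t) F_n(w) + (−t)ⁿ; both sides satisfy the Fibonacci recurrence.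
-- Taking coefficients, b_k(n, m) = D(I) + D(J) with D(i) the coefficient of tⁱ in
-- (1 + 2t) F_{2m}(w) = Σ_j [wʲ]F_{2m} · (1 + 2t)wʲ and {I, J} = {2n − 2, k − 2n}: the
-- Kronecker delta is the (−t)^{2m} correction, which misses the odd offset k − 2n.
-- Hence a vanishing combination of the selected rows gives two triangular systems.
-- First, F_{2m} has w-degree m − 1 with nonzero top coefficient, so the combination
-- pairs to zero with every (1 + 2t)wʲ, j < κ.  Second, (1 + 2t)wʲ lives in degrees
-- j … 2j + 1 with coefficient 1 at tʲ; the smaller offsets I of the rows n_ℓ are κ
-- distinct numbers below κ, and 3κ ≤ k puts every larger offset J beyond 2j + 1 for
-- j > I.  Back substitution then kills all coefficients.

open import Algebra.Bundles using (Ring)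
open import Data.Bool using (Bool; true; false; T; if_then_else_)
open import Data.Fin using (Fin; toℕ; zero; suc; fromℕ<; inject≤)
open import Data.Fin.Properties
  using (punchInᵢ≢i; toℕ-inject₁; toℕ-fromℕ; toℕ-fromℕ<; toℕ<n; toℕ-injective; toℕ-inject≤)
open import Data.Integer as ℤ using (ℤ)
import Data.Integer.Properties as ℤ
open import Data.Nat as ℕ using (ℕ; zero; suc; _≤_; _<_; _∸_; _≤ᵇ_; z≤n; s≤s)
import Data.Nat.Coprimality as Coprime
open import Data.Nat.Combinatorics using (_C_; nCk+nC[k+1]≡[n+1]C[k+1])
open import Data.Nat.DivMod using (_/_; _%_; m/n*n≤m; m≡m%n+[m/n]*n; m%n<n; m*n/n≡m; m<n*o⇒m/o<n)
open import Data.Nat.Induction using (<-rec)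
import Data.Nat.Properties as ℕ
open import Data.Nat.Tactic.RingSolver using (solve-∀)
open import Data.Product using (_×_; _,_; proj₁; proj₂; ∃)
open import Data.Rational as ℚ using (ℚ; 0ℚ; 1ℚ; _+_; _*_; _-_; -_)
import Data.Rational.Properties as ℚ
open import Data.Rational.Solver using (module +-*-Solver)
open import Data.Sum using (_⊎_; inj₁; inj₂)
open import Data.Unit using (tt)
open import Data.Vec.Functional using (removeAt)
open import Function.Base using (_∘_)
open import Function.Definitions using (Injective)
open import Relation.Binary.Definitions using (tri<; tri≈; tri>)
open import Relation.Binary.PropositionalEquality hiding (J)
open import Relation.Nullary using (contradiction; yes; no)

open import Defs using (toℚ; Σ; b; binom; δ; κ; K; nIdx; 𝒮; 𝒞; RowsIndependent; RankAtLeast)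

open import Algebra.Properties.Semiring.Sum (Ring.semiring ℚ.+-*-ring)
open +-*-Solver

-- Rationals, finite sums and triangular systems

Σ≡sum : ∀ n (f : Fin n → ℚ) → Σ n f ≡ sum f
Σ≡sum zero f = refl
Σ≡sum (suc n) f = cong (f zero +_) (Σ≡sum n (λ i → f (suc i)))

toℚ≡mkℚ : ∀ i → toℚ i ≡ ℚ.mkℚ i 0 (Coprime.sym (Coprime.1-coprimeTo ℤ.∣ i ∣))
toℚ≡mkℚ i = ℚ.↥p/↧p≡p (ℚ.mkℚ i 0 (Coprime.sym (Coprime.1-coprimeTo ℤ.∣ i ∣)))

toℚ-+ : ∀ i j → toℚ (i ℤ.+ j) ≡ toℚ i + toℚ j
toℚ-+ i j = begin
  toℚ (i ℤ.+ j)                      ≡⟨ cong (ℚ._/ 1) (cong₂ ℤ._+_ (ℤ.*-identityʳ i) (ℤ.*-identityʳ j)) ⟨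
  (i ℤ.* ℤ.1ℤ ℤ.+ j ℤ.* ℤ.1ℤ) ℚ./ 1  ≡⟨ cong₂ _+_ (toℚ≡mkℚ i) (toℚ≡mkℚ j) ⟨
  toℚ i + toℚ j                      ∎
  where open ≡-Reasoning

toℚ-neg : ∀ i → toℚ (ℤ.- i) ≡ - toℚ i
toℚ-neg i = trans (toℚ≡mkℚ (ℤ.- i)) (trans (mkℚ-neg i) (cong -_ (sym (toℚ≡mkℚ i))))
  where
  mkℚ-neg : ∀ i → ℚ.mkℚ (ℤ.- i) 0 (Coprime.sym (Coprime.1-coprimeTo ℤ.∣ ℤ.- i ∣)) ≡
                   - ℚ.mkℚ i 0 (Coprime.sym (Coprime.1-coprimeTo ℤ.∣ i ∣))
  mkℚ-neg (ℤ.+ zero) = refl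
  mkℚ-neg (ℤ.+ suc n) = refl
  mkℚ-neg ℤ.-[1+ n ] = refl

↥-toℚ : ∀ i → ℚ.↥ toℚ i ≡ i
↥-toℚ i = cong ℚ.↥_ (toℚ≡mkℚ i)

ι : ℕ → ℚ
ι n = toℚ (ℤ.+ n)

ι-+ : ∀ m n → ι (m ℕ.+ n) ≡ ι m + ι n
ι-+ m n = trans (cong toℚ (ℤ.pos-+ m n)) (toℚ-+ (ℤ.+ m) (ℤ.+ n))

ι-nonZero : ∀ {n} → 1 ≤ n → ι n ≢ 0ℚ
ι-nonZero {suc n} _ ιn≡0 with () ← trans (sym (↥-toℚ (ℤ.+ suc n))) (cong ℚ.↥_ ιn≡0)

*-cancelʳ-≡0 : ∀ x y → y ≢ 0ℚ → x * y ≡ 0ℚ → x ≡ 0ℚ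
*-cancelʳ-≡0 x y y≢0 xy≡0 = begin
  x                ≡⟨ ℚ.*-identityʳ x ⟨
  x * 1ℚ           ≡⟨ cong (x *_) (ℚ.*-inverseʳ y) ⟨
  x * (y * 1/y)    ≡⟨ ℚ.*-assoc x y 1/y ⟨
  x * y * 1/y      ≡⟨ cong (_* 1/y) xy≡0 ⟩
  0ℚ * 1/y         ≡⟨ ℚ.*-zeroˡ 1/y ⟩
  0ℚ               ∎
  where
  open ≡-Reasoning
  instance _ = ℚ.≢-nonZero y≢0
  1/y = ℚ.1/ y

sum-single : ∀ {n} (f : Fin n → ℚ) i → (∀ j → j ≢ i → f j ≡ 0ℚ) → sum f ≡ f i
sum-single {suc n} f i others = begin
  sum f                     ≡⟨ sum-remove {i = i} f ⟩
  f i + sum (removeAt f i)  ≡⟨ cong (f i +_) (trans (sum-cong-≗ (λ j → others _ (punchInᵢ≢i i j)))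
                                                    (sum-replicate-zero n)) ⟩
  f i + 0ℚ                  ≡⟨ ℚ.+-identityʳ (f i) ⟩
  f i                       ∎
  where open ≡-Reasoning

sum-toℕ-last : ∀ n (f : ℕ → ℚ) → ∑[ j < suc n ] f (toℕ j) ≡ ∑[ j < n ] f (toℕ j) + f n
sum-toℕ-last n f = trans (sum-init-last {n} (λ j → f (toℕ j)))
  (cong₂ _+_ (sum-cong-≗ {n} (λ j → cong f (toℕ-inject₁ j))) (cong f (toℕ-fromℕ n)))

sum-truncate : ∀ {a b} (f : ℕ → ℚ) → b ≤ a → (∀ j → b ≤ j → f j ≡ 0ℚ) →
               ∑[ j < a ] f (toℕ j) ≡ ∑[ j < b ] f (toℕ j)
sum-truncate {a} {b} f b≤a vanish with ℕ.m≤n⇒m<n∨m≡n b≤a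
... | inj₂ refl = refl
sum-truncate {suc a} {b} f b≤a vanish | inj₁ b<1+a = begin
  ∑[ j < suc a ] f (toℕ j)   ≡⟨ sum-toℕ-last a f ⟩
  ∑[ j < a ] f (toℕ j) + f a ≡⟨ cong (λ z → ∑[ j < a ] f (toℕ j) + z) (vanish a (ℕ.≤-pred b<1+a)) ⟩
  ∑[ j < a ] f (toℕ j) + 0ℚ  ≡⟨ ℚ.+-identityʳ _ ⟩
  ∑[ j < a ] f (toℕ j)       ≡⟨ sum-truncate f (ℕ.≤-pred b<1+a) vanish ⟩
  ∑[ j < b ] f (toℕ j)       ∎
  where open ≡-Reasoning

module _ {n} (μ : Fin n → ℕ) (μ-injective : Injective _≡_ _≡_ μ)
         (E : Fin n → Fin n → ℚ) (E-upper : ∀ i j → μ i < μ j → E i j ≡ 0ℚ)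
         (E-diagonal : ∀ i → E i i ≢ 0ℚ) where

  triangular-kernel : (x : Fin n → ℚ) → (∀ i → ∑[ j < n ] (x j * E i j) ≡ 0ℚ) → ∀ i → x i ≡ 0ℚ
  triangular-kernel x solves i = <-rec P step (μ i) i refl
    where
    P : ℕ → Set
    P d = ∀ i → μ i ≡ d → x i ≡ 0ℚ
    step : ∀ d → (∀ {d′} → d′ < d → P d′) → P d
    step _ below i refl =
      *-cancelʳ-≡0 (x i) (E i i) (E-diagonal i) (trans (sym (sum-single _ i others)) (solves i))
      where
      others : ∀ j → j ≢ i → x j * E i j ≡ 0ℚ
      others j j≢i with ℕ.<-cmp (μ j) (μ i)
      ... | tri< μj<μi _ _ = trans (cong (_* E i j) (below μj<μi j refl)) (ℚ.*-zeroˡ (E i j))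
      ... | tri≈ _ μj≡μi _ = contradiction (μ-injective μj≡μi) j≢i
      ... | tri> _ _ μi<μj = trans (cong (x j *_) (E-upper i j μi<μj)) (ℚ.*-zeroʳ (x j))

RowsIndependent-cong : ∀ {p q} {A B : Fin p → Fin q → ℚ} → (∀ i j → A i j ≡ B i j) →
                       RowsIndependent p q A → RowsIndependent p q B
RowsIndependent-cong {p} A≡B indep y combination = indep y λ j →
  trans (trans (Σ≡sum p _) (trans (sum-cong-≗ {p} (λ i → cong (y i *_) (A≡B i j))) (sym (Σ≡sum p _))))
        (combination j)

RowsIndependent-extendColumns : ∀ {p q r} (A : Fin p → Fin q → ℚ) (τ : Fin r → Fin q) →
  RowsIndependent p r (λ i j → A i (τ j)) → RowsIndependent p q A
RowsIndependent-extendColumns A τ indep y combination = indep y (λ j → combination (τ j))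

-- Fibonacci polynomials in w = t + t²

-- fib n j is the coefficient of wʲ in F_n(w).
fib : ℕ → ℕ → ℕ
fib zero j = 0
fib (suc zero) zero = 1
fib (suc zero) (suc j) = 0
fib (suc (suc n)) zero = fib (suc n) zero
fib (suc (suc n)) (suc j) = fib (suc n) (suc j) ℕ.+ fib n j

fib-vanishes : ∀ {n j} → n ≤ 2 ℕ.* j → fib n j ≡ 0
fib-vanishes {zero} _ = refl
fib-vanishes {suc zero} {zero} ()
fib-vanishes {suc zero} {suc j} _ = refl
fib-vanishes {suc (suc n)} {zero} ()
fib-vanishes {suc (suc n)} {suc j} n+2≤2j+2 =
  cong₂ ℕ._+_ (fib-vanishes (ℕ.≤-trans (ℕ.n≤1+n _) n+2≤2j+2)) (fib-vanishes n≤2j)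
  where
  n≤2j : n ≤ 2 ℕ.* j
  n≤2j = ℕ.+-cancelˡ-≤ 2 n (2 ℕ.* j) (subst (2 ℕ.+ n ≤_) (ℕ.*-suc 2 j) n+2≤2j+2)

fib-leading : ∀ m → 1 ≤ fib (2 ℕ.* suc m) m
fib-leading zero = s≤s z≤n
fib-leading (suc m) = subst (λ n → 1 ≤ fib n (suc m)) (sym (ℕ.*-suc 2 (suc m)))
  (ℕ.≤-trans (fib-leading m) (ℕ.m≤n+m _ _))

-- wPow j i is the coefficient of tⁱ in (1 + 2t)wʲ.
wPow : ℕ → ℕ → ℕ
wPow zero zero = 1
wPow zero (suc zero) = 2
wPow zero (suc (suc i)) = 0
wPow (suc j) zero = 0
wPow (suc j) (suc zero) = wPow j zero
wPow (suc j) (suc (suc i)) = wPow j (suc i) ℕ.+ wPow j i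

wPow-below : ∀ {j i} → i < j → wPow j i ≡ 0
wPow-below {suc j} {zero} _ = refl
wPow-below {suc j} {suc zero} (s≤s 0<j) = wPow-below 0<j
wPow-below {suc j} {suc (suc i)} (s≤s i+1<j) =
  cong₂ ℕ._+_ (wPow-below i+1<j) (wPow-below (ℕ.<-trans (ℕ.n<1+n i) i+1<j))

wPow-diagonal : ∀ j → wPow j j ≡ 1
wPow-diagonal zero = refl
wPow-diagonal (suc zero) = refl
wPow-diagonal (suc (suc j)) = cong₂ ℕ._+_ (wPow-diagonal (suc j)) (wPow-below (ℕ.n<1+n j))

wPow-above : ∀ {j i} → 2 ℕ.* j ℕ.+ 1 < i → wPow j i ≡ 0
wPow-above {zero} {suc zero} (s≤s ())
wPow-above {zero} {suc (suc i)} _ = refl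
wPow-above {suc j} {suc zero} (s≤s ())
wPow-above {suc j} {suc (suc i)} 2j+3<i+2 =
  cong₂ ℕ._+_ (wPow-above {j} (ℕ.<-trans 2j+1<i (ℕ.n<1+n i))) (wPow-above {j} 2j+1<i)
  where
  2j+1<i : 2 ℕ.* j ℕ.+ 1 < i
  2j+1<i = ℕ.≤-pred (ℕ.≤-pred (subst (_< 2 ℕ.+ i) (cong (ℕ._+ 1) (ℕ.*-suc 2 j)) 2j+3<i+2))

-- Multiplication of a power series in t by w.
mulW : (ℕ → ℚ) → ℕ → ℚ
mulW f zero = 0ℚ
mulW f (suc zero) = f zero
mulW f (suc (suc i)) = f (suc i) + f i

mulW-cong : ∀ {f g} → (∀ i → f i ≡ g i) → ∀ i → mulW f i ≡ mulW g i
mulW-cong f≗g zero = refl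
mulW-cong f≗g (suc zero) = f≗g zero
mulW-cong f≗g (suc (suc i)) = cong₂ _+_ (f≗g (suc i)) (f≗g i)

mulW-+ : ∀ f g i → mulW (λ i → f i + g i) i ≡ mulW f i + mulW g i
mulW-+ f g zero = sym (ℚ.+-identityʳ 0ℚ)
mulW-+ f g (suc zero) = refl
mulW-+ f g (suc (suc i)) = solve 4 (λ a b c d → (a :+ b) :+ (c :+ d) := (a :+ c) :+ (b :+ d)) refl
  (f (suc i)) (g (suc i)) (f i) (g i)

mulW-linear : ∀ {m} (c : Fin m → ℚ) (f : Fin m → ℕ → ℚ) i →
              mulW (λ i → ∑[ j < m ] (c j * f j i)) i ≡ ∑[ j < m ] (c j * mulW (f j) i)
mulW-linear {m} c f zero = sym (trans (sum-cong-≗ {m} (λ j → ℚ.*-zeroʳ (c j))) (sum-replicate-zero m))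
mulW-linear c f (suc zero) = refl
mulW-linear c f (suc (suc i)) = sym (trans
  (sum-cong-≗ (λ j → ℚ.*-distribˡ-+ (c j) (f j (suc i)) (f j i)))
  (∑-distrib-+ (λ j → c j * f j (suc i)) (λ j → c j * f j i)))

ι-wPow-suc : ∀ j i → ι (wPow (suc j) i) ≡ mulW (λ i → ι (wPow j i)) i
ι-wPow-suc j zero = refl
ι-wPow-suc j (suc zero) = refl
ι-wPow-suc j (suc (suc i)) = ι-+ (wPow j (suc i)) (wPow j i)

FibonacciRecurrence : (ℕ → ℕ → ℚ) → Set
FibonacciRecurrence S = ∀ n i → S (suc (suc n)) i ≡ S (suc n) i + mulW (S n) i

FibonacciRecurrence-unique : ∀ {S T} → FibonacciRecurrence S → FibonacciRecurrence T →
  (∀ i → S 0 i ≡ T 0 i) → (∀ i → S 1 i ≡ T 1 i) → ∀ n i → S n i ≡ T n i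
FibonacciRecurrence-unique {S} {T} recS recT S₀≗T₀ S₁≗T₁ n = proj₁ (agree n)
  where
  agree : ∀ n → (∀ i → S n i ≡ T n i) × (∀ i → S (suc n) i ≡ T (suc n) i)
  agree zero = S₀≗T₀ , S₁≗T₁
  agree (suc n) with agree n
  ... | Sₙ≗Tₙ , Sₙ₊₁≗Tₙ₊₁ = Sₙ₊₁≗Tₙ₊₁ , λ i →
    trans (recS n i) (trans (cong₂ _+_ (Sₙ₊₁≗Tₙ₊₁ i) (mulW-cong Sₙ≗Tₙ i)) (sym (recT n i)))

binomial-recurrence : FibonacciRecurrence (λ n i → ι (n C i))
binomial-recurrence n zero = sym (ℚ.+-identityʳ (ι 1))
binomial-recurrence n (suc zero) = begin
  ι (suc (suc n) C 1)     ≡⟨ cong ι (nCk+nC[k+1]≡[n+1]C[k+1] (suc n) 0) ⟨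
  ι (1 ℕ.+ suc n C 1)     ≡⟨ cong ι (ℕ.+-comm 1 (suc n C 1)) ⟩
  ι (suc n C 1 ℕ.+ 1)     ≡⟨ ι-+ (suc n C 1) 1 ⟩
  ι (suc n C 1) + ι 1     ∎
  where open ≡-Reasoning
binomial-recurrence n (suc (suc i)) = begin
  ι (suc (suc n) C suc (suc i))
    ≡⟨ cong ι (nCk+nC[k+1]≡[n+1]C[k+1] (suc n) (suc i)) ⟨
  ι (suc n C suc i ℕ.+ suc n C suc (suc i))
    ≡⟨ cong (λ c → ι (c ℕ.+ suc n C suc (suc i))) (nCk+nC[k+1]≡[n+1]C[k+1] n i) ⟨
  ι (n C i ℕ.+ n C suc i ℕ.+ suc n C suc (suc i))
    ≡⟨ cong ι (ℕ.+-comm (n C i ℕ.+ n C suc i) _) ⟩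
  ι (suc n C suc (suc i) ℕ.+ (n C i ℕ.+ n C suc i))
    ≡⟨ ι-+ (suc n C suc (suc i)) _ ⟩
  ι (suc n C suc (suc i)) + ι (n C i ℕ.+ n C suc i)
    ≡⟨ cong (ι (suc n C suc (suc i)) +_) (trans (ι-+ (n C i) (n C suc i)) (ℚ.+-comm (ι (n C i)) _)) ⟩
  ι (suc n C suc (suc i)) + (ι (n C suc i) + ι (n C i)) ∎
  where open ≡-Reasoning

-- negTPow n i is the coefficient of tⁱ in (−t)ⁿ.
negTPow : ℕ → ℕ → ℚ
negTPow zero zero = 1ℚ
negTPow zero (suc i) = 0ℚ
negTPow (suc n) zero = 0ℚ
negTPow (suc n) (suc i) = - negTPow n i

negTPow-recurrence : FibonacciRecurrence negTPow
negTPow-recurrence n zero = sym (ℚ.+-identityʳ 0ℚ)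
negTPow-recurrence n (suc zero) = sym (ℚ.+-inverseˡ (negTPow n 0))
negTPow-recurrence n (suc (suc i)) =
  solve 2 (λ a b → :- (:- b) := (:- a) :+ (a :+ b)) refl (negTPow n (suc i)) (negTPow n i)

negTPow-off-diagonal : ∀ {n i} → i ≢ n → negTPow n i ≡ 0ℚ
negTPow-off-diagonal {zero} {zero} i≢n = contradiction refl i≢n
negTPow-off-diagonal {zero} {suc i} _ = refl
negTPow-off-diagonal {suc n} {zero} _ = refl
negTPow-off-diagonal {suc n} {suc i} i≢n = cong -_ (negTPow-off-diagonal (i≢n ∘ cong suc))

negTPow-even-diagonal : ∀ m → negTPow (2 ℕ.* m) (2 ℕ.* m) ≡ 1ℚ
negTPow-even-diagonal zero = refl
negTPow-even-diagonal (suc m) rewrite ℕ.+-suc m (m ℕ.+ 0) =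
  trans (solve 1 (λ a → :- (:- a) := a) refl (negTPow (2 ℕ.* m) (2 ℕ.* m))) (negTPow-even-diagonal m)

-- fibExpansion n i is the coefficient of tⁱ in (1 + 2t) F_n(w).
fibExpansion : ℕ → ℕ → ℚ
fibExpansion n i = ∑[ j < n ] (ι (fib n (toℕ j)) * ι (wPow (toℕ j) i))

fibExpansion-recurrence : FibonacciRecurrence fibExpansion
fibExpansion-recurrence n i = begin
  fibExpansion (suc (suc n)) i
    ≡⟨ cong (lead +_) (trans (sum-cong-≗ {suc n} (λ j → split (toℕ j)))
                             (∑-distrib-+ {suc n} (A ∘ toℕ) (B ∘ toℕ))) ⟩
  lead + (∑[ j < suc n ] A (toℕ j) + ∑[ j < suc n ] B (toℕ j))
    ≡⟨ ℚ.+-assoc lead _ _ ⟨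
  lead + ∑[ j < suc n ] A (toℕ j) + ∑[ j < suc n ] B (toℕ j)
    ≡⟨ cong₂ (λ a b → lead + a + b) (sum-truncate A (ℕ.n≤1+n n) A-vanishes)
                                    (sum-truncate B (ℕ.n≤1+n n) B-vanishes) ⟩
  fibExpansion (suc n) i + ∑[ j < n ] B (toℕ j)
    ≡⟨ cong (fibExpansion (suc n) i +_)
            (sum-cong-≗ {n} (λ j → cong (ι (fib n (toℕ j)) *_) (ι-wPow-suc (toℕ j) i))) ⟩
  fibExpansion (suc n) i + ∑[ j < n ] (ι (fib n (toℕ j)) * mulW (λ i → ι (wPow (toℕ j) i)) i)
    ≡⟨ cong (fibExpansion (suc n) i +_)
            (mulW-linear {n} (λ j → ι (fib n (toℕ j))) (λ j i → ι (wPow (toℕ j) i)) i) ⟨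
  fibExpansion (suc n) i + mulW (fibExpansion n) i
    ∎
  where
  open ≡-Reasoning
  lead = ι (fib (suc n) 0) * ι (wPow 0 i)
  A B : ℕ → ℚ
  A j = ι (fib (suc n) (suc j)) * ι (wPow (suc j) i)
  B j = ι (fib n j) * ι (wPow (suc j) i)
  split : ∀ j → ι (fib (suc (suc n)) (suc j)) * ι (wPow (suc j) i) ≡ A j + B j
  split j = trans (cong (_* ι (wPow (suc j) i)) (ι-+ (fib (suc n) (suc j)) (fib n j)))
                  (ℚ.*-distribʳ-+ (ι (wPow (suc j) i)) (ι (fib (suc n) (suc j))) (ι (fib n j)))
  vanishing-term : ∀ {m j} w → m ≤ 2 ℕ.* j → ι (fib m j) * w ≡ 0ℚ
  vanishing-term {m} {j} w m≤2j = trans (cong (λ c → ι c * w) (fib-vanishes m≤2j)) (ℚ.*-zeroˡ w)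
  A-vanishes : ∀ j → n ≤ j → A j ≡ 0ℚ
  A-vanishes j n≤j = vanishing-term _ (ℕ.≤-trans (s≤s n≤j) (ℕ.m≤n*m (suc j) 2))
  B-vanishes : ∀ j → n ≤ j → B j ≡ 0ℚ
  B-vanishes j n≤j = vanishing-term _ (ℕ.≤-trans n≤j (ℕ.m≤n*m j 2))

FibonacciRecurrence-+ : ∀ {S T} → FibonacciRecurrence S → FibonacciRecurrence T →
                        FibonacciRecurrence (λ n i → S n i + T n i)
FibonacciRecurrence-+ {S} {T} recS recT n i = begin
  S (2 ℕ.+ n) i + T (2 ℕ.+ n) i
    ≡⟨ cong₂ _+_ (recS n i) (recT n i) ⟩
  (S (suc n) i + mulW (S n) i) + (T (suc n) i + mulW (T n) i)
    ≡⟨ solve 4 (λ a b c d → (a :+ b) :+ (c :+ d) := (a :+ c) :+ (b :+ d)) refl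
         (S (suc n) i) (mulW (S n) i) (T (suc n) i) (mulW (T n) i) ⟩
  (S (suc n) i + T (suc n) i) + (mulW (S n) i + mulW (T n) i)
    ≡⟨ cong (S (suc n) i + T (suc n) i +_) (mulW-+ (S n) (T n) i) ⟨
  (S (suc n) i + T (suc n) i) + mulW (λ i → S n i + T n i) i
    ∎
  where open ≡-Reasoning

binomial≡fibExpansion+negTPow : ∀ n i → ι (n C i) ≡ fibExpansion n i + negTPow n i
binomial≡fibExpansion+negTPow = FibonacciRecurrence-unique binomial-recurrence
  (FibonacciRecurrence-+ {fibExpansion} {negTPow} fibExpansion-recurrence negTPow-recurrence)
  initial₀ initial₁
  where
  initial₀ : ∀ i → ι (0 C i) ≡ fibExpansion 0 i + negTPow 0 i
  initial₀ zero = refl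
  initial₀ (suc i) = refl
  initial₁ : ∀ i → ι (1 C i) ≡ fibExpansion 1 i + negTPow 1 i
  initial₁ zero = refl
  initial₁ (suc zero) = refl
  initial₁ (suc (suc i)) = refl

-- The entries of 𝒞_k

δ-≡ : ∀ {a b} → a ≡ b → δ a b ≡ ℤ.+ 1
δ-≡ {a} {b} a≡b with a ℤ.≟ b
... | yes _ = refl
... | no a≢b = contradiction a≡b a≢b

δ-≢ : ∀ {a b} → a ≢ b → δ a b ≡ ℤ.+ 0
δ-≢ {a} {b} a≢b with a ℤ.≟ b
... | yes a≡b = contradiction a≡b a≢b
... | no _ = refl

pos-∸ : ∀ {a c} → c ≤ a → ℤ.+ a ℤ.- ℤ.+ c ≡ ℤ.+ (a ∸ c)
pos-∸ {a} {c} c≤a = trans (ℤ.m-n≡m⊖n a c) (ℤ.⊖-≥ c≤a)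

toℚ-δ≡negTPow : ∀ m c → toℚ (δ (ℤ.+ suc c) (ℤ.+ suc (2 ℕ.* m))) ≡ negTPow (2 ℕ.* m) c
toℚ-δ≡negTPow m c with c ℕ.≟ 2 ℕ.* m
... | yes refl = trans (cong toℚ (δ-≡ {ℤ.+ suc (2 ℕ.* m)} refl)) (sym (negTPow-even-diagonal m))
... | no c≢2m = trans (cong toℚ (δ-≢ (c≢2m ∘ ℕ.suc-injective ∘ ℤ.+-injective)))
                      (sym (negTPow-off-diagonal c≢2m))

odd-∸-even : ∀ {K ℓ} → ℓ ≤ K → 2 ℕ.* K ℕ.+ 1 ∸ 2 ℕ.* ℓ ≡ suc (2 ℕ.* (K ∸ ℓ))
odd-∸-even {K} {ℓ} ℓ≤K = begin
  2 ℕ.* K ℕ.+ 1 ∸ 2 ℕ.* ℓ    ≡⟨ ℕ.+-∸-comm 1 (ℕ.*-monoʳ-≤ 2 ℓ≤K) ⟩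
  2 ℕ.* K ∸ 2 ℕ.* ℓ ℕ.+ 1    ≡⟨ cong (ℕ._+ 1) (ℕ.*-distribˡ-∸ 2 K ℓ) ⟨
  2 ℕ.* (K ∸ ℓ) ℕ.+ 1        ≡⟨ ℕ.+-comm (2 ℕ.* (K ∸ ℓ)) 1 ⟩
  suc (2 ℕ.* (K ∸ ℓ))        ∎
  where open ≡-Reasoning

b≡binomials : ∀ K ℓ m → 1 ≤ ℓ → ℓ ≤ K →
  b (2 ℕ.* K ℕ.+ 1) ℓ m ≡
  ℤ.+ (2 ℕ.* m C (2 ℕ.* ℓ ∸ 2)) ℤ.+ ℤ.+ (2 ℕ.* m C (2 ℕ.* K ℕ.+ 1 ∸ 2 ℕ.* ℓ))
    ℤ.- δ (ℤ.+ suc (2 ℕ.* ℓ ∸ 2)) (ℤ.+ suc (2 ℕ.* m))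
b≡binomials K ℓ m 1≤ℓ ℓ≤K =
  trans (cong₂ (λ x y → binom (ℤ.+ (2 ℕ.* m)) x ℤ.+ binom (ℤ.+ (2 ℕ.* m)) y
                          ℤ.- δ (ℤ.+ (2 ℕ.* ℓ) ℤ.- ℤ.+ 1) (ℤ.+ (2 ℕ.* m) ℤ.+ ℤ.+ 1))
               (pos-∸ 2≤2ℓ) (pos-∸ 2ℓ≤k))
        (cong (λ z → binomials ℤ.- z) (cong₂ δ δ-left δ-right))
  where
  binomials = ℤ.+ (2 ℕ.* m C (2 ℕ.* ℓ ∸ 2)) ℤ.+ ℤ.+ (2 ℕ.* m C (2 ℕ.* K ℕ.+ 1 ∸ 2 ℕ.* ℓ))
  2≤2ℓ : 2 ≤ 2 ℕ.* ℓ
  2≤2ℓ = ℕ.*-monoʳ-≤ 2 1≤ℓ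
  2ℓ≤k : 2 ℕ.* ℓ ≤ 2 ℕ.* K ℕ.+ 1
  2ℓ≤k = ℕ.≤-trans (ℕ.*-monoʳ-≤ 2 ℓ≤K) (ℕ.m≤m+n (2 ℕ.* K) 1)
  δ-left : ℤ.+ (2 ℕ.* ℓ) ℤ.- ℤ.+ 1 ≡ ℤ.+ suc (2 ℕ.* ℓ ∸ 2)
  δ-left = trans (pos-∸ (ℕ.≤-trans (s≤s z≤n) 2≤2ℓ)) (cong ℤ.+_ (ℕ.+-∸-assoc 1 2≤2ℓ))
  δ-right : ℤ.+ (2 ℕ.* m) ℤ.+ ℤ.+ 1 ≡ ℤ.+ suc (2 ℕ.* m)
  δ-right = trans (sym (ℤ.pos-+ (2 ℕ.* m) 1)) (cong ℤ.+_ (ℕ.+-comm (2 ℕ.* m) 1))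

b≡fibExpansion : ∀ K ℓ m → 1 ≤ ℓ → ℓ ≤ K →
  toℚ (b (2 ℕ.* K ℕ.+ 1) ℓ m) ≡
  fibExpansion (2 ℕ.* m) (2 ℕ.* ℓ ∸ 2) + fibExpansion (2 ℕ.* m) (2 ℕ.* K ℕ.+ 1 ∸ 2 ℕ.* ℓ)
b≡fibExpansion K ℓ m 1≤ℓ ℓ≤K = begin
  toℚ (b (2 ℕ.* K ℕ.+ 1) ℓ m)
    ≡⟨ cong toℚ (b≡binomials K ℓ m 1≤ℓ ℓ≤K) ⟩
  toℚ (ℤ.+ (M C c) ℤ.+ ℤ.+ (M C o) ℤ.- d)
    ≡⟨ trans (toℚ-+ (ℤ.+ (M C c) ℤ.+ ℤ.+ (M C o)) (ℤ.- d))
             (cong₂ _+_ (toℚ-+ (ℤ.+ (M C c)) (ℤ.+ (M C o))) (toℚ-neg d)) ⟩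
  ι (M C c) + ι (M C o) - toℚ d
    ≡⟨ cong₂ (λ x y → x + y - toℚ d)
             (binomial≡fibExpansion+negTPow M c) (binomial≡fibExpansion+negTPow M o) ⟩
  (F c + negTPow M c) + (F o + negTPow M o) - toℚ d
    ≡⟨ cong₂ (λ x y → (F c + negTPow M c) + (F o + x) - y) (negTPow-off-diagonal o≢M) (toℚ-δ≡negTPow m c) ⟩
  (F c + negTPow M c) + (F o + 0ℚ) - negTPow M c
    ≡⟨ solve 3 (λ x y z → (x :+ z) :+ (y :+ con 0ℚ) :- z := x :+ y) refl (F c) (F o) (negTPow M c) ⟩
  F c + F o
    ∎
  where
  open ≡-Reasoning
  M = 2 ℕ.* m
  c = 2 ℕ.* ℓ ∸ 2
  o = 2 ℕ.* K ℕ.+ 1 ∸ 2 ℕ.* ℓ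
  d = δ (ℤ.+ suc c) (ℤ.+ suc M)
  F : ℕ → ℚ
  F = fibExpansion M
  o≢M : o ≢ M
  o≢M o≡M = ℕ.even≢odd m (K ∸ ℓ) (trans (sym o≡M) (odd-∸-even ℓ≤K))

-- Independence of paired rows

fibExpansion-+ : ∀ n a c → fibExpansion n a + fibExpansion n c ≡
  ∑[ j < n ] (ι (fib n (toℕ j)) * (ι (wPow (toℕ j) a) + ι (wPow (toℕ j) c)))
fibExpansion-+ n a c = sym (trans
  (sum-cong-≗ {n} (λ j → ℚ.*-distribˡ-+ (g j) (ι (wPow (toℕ j) a)) (ι (wPow (toℕ j) c))))
  (∑-distrib-+ {n} (λ j → g j * ι (wPow (toℕ j) a)) (λ j → g j * ι (wPow (toℕ j) c))))
  where
  g : Fin n → ℚ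
  g j = ι (fib n (toℕ j))

module _ {p} (I J : Fin p → ℕ) (I-injective : Injective _≡_ _≡_ I) (I<p : ∀ ℓ → I ℓ < p)
         (J-large : ∀ ℓ d → I ℓ < d → d < p → 2 ℕ.* d ℕ.+ 1 < J ℓ) where

  wPowPair : ℕ → Fin p → ℚ
  wPowPair j ℓ = ι (wPow j (I ℓ)) + ι (wPow j (J ℓ))

  -- The equations for y are W (I ℓ) = 0, a triangular system for decreasing I ℓ.
  pairedRows-independent : (y : Fin p → ℚ) →
    (∀ (m : Fin p) → ∑[ ℓ < p ] (y ℓ * (fibExpansion (2 ℕ.* suc (toℕ m)) (I ℓ) +
                                        fibExpansion (2 ℕ.* suc (toℕ m)) (J ℓ))) ≡ 0ℚ) →
    ∀ ℓ → y ℓ ≡ 0ℚ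
  pairedRows-independent y rows = triangular-kernel (λ ℓ → p ∸ I ℓ) opposite-injective
    (λ ℓ ℓ′ → wPowPair (I ℓ) ℓ′) wPowPair-upper wPowPair-diagonal y (λ ℓ → W-vanishes (I ℓ) (I<p ℓ))
    where
    W : ℕ → ℚ
    W j = ∑[ ℓ < p ] (y ℓ * wPowPair j ℓ)

    G : Fin p → ℕ → ℚ
    G m j = ι (fib (2 ℕ.* suc (toℕ m)) j)

    G-vanishes : ∀ m j → suc (toℕ m) ≤ j → G m j ≡ 0ℚ
    G-vanishes m j m<j = cong ι (fib-vanishes (ℕ.*-monoʳ-≤ 2 m<j))

    W-equations : ∀ m → ∑[ j < p ] (W (toℕ j) * G m (toℕ j)) ≡ 0ℚ
    W-equations m = begin
      ∑[ j < p ] (W (toℕ j) * G m (toℕ j))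
        ≡⟨ sum-truncate (λ j → W j * G m j) (toℕ<n m) WG-vanishes ⟩
      ∑[ j < suc (toℕ m) ] (W (toℕ j) * G m (toℕ j))
        ≡⟨ sum-truncate (λ j → W j * G m j) (ℕ.m≤n*m (suc (toℕ m)) 2) WG-vanishes ⟨
      ∑[ j < n ] (W (toℕ j) * G m (toℕ j))
        ≡⟨ sum-cong-≗ {n} (λ j → trans (*-distribʳ-sum (G m (toℕ j)) (λ ℓ → y ℓ * wPowPair (toℕ j) ℓ))
                                        (sum-cong-≗ {p} (λ ℓ → reassoc (y ℓ) _ _))) ⟩
      ∑[ j < n ] ∑[ ℓ < p ] (y ℓ * (G m (toℕ j) * wPowPair (toℕ j) ℓ))
        ≡⟨ ∑-comm {n} {p} (λ j ℓ → y ℓ * (G m (toℕ j) * wPowPair (toℕ j) ℓ)) ⟩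
      ∑[ ℓ < p ] ∑[ j < n ] (y ℓ * (G m (toℕ j) * wPowPair (toℕ j) ℓ))
        ≡⟨ sum-cong-≗ {p} (λ ℓ → trans (sym (*-distribˡ-sum {n} (y ℓ) (λ j → G m (toℕ j) * wPowPair (toℕ j) ℓ)))
                                        (cong (y ℓ *_) (sym (fibExpansion-+ n (I ℓ) (J ℓ))))) ⟩
      ∑[ ℓ < p ] (y ℓ * (fibExpansion n (I ℓ) + fibExpansion n (J ℓ)))
        ≡⟨ rows m ⟩
      0ℚ ∎
      where
      open ≡-Reasoning
      n = 2 ℕ.* suc (toℕ m)
      WG-vanishes : ∀ j → suc (toℕ m) ≤ j → W j * G m j ≡ 0ℚ
      WG-vanishes j m<j = trans (cong (W j *_) (G-vanishes m j m<j)) (ℚ.*-zeroʳ (W j))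
      reassoc : ∀ a b c → a * c * b ≡ a * (b * c)
      reassoc = solve 3 (λ a b c → a :* c :* b := a :* (b :* c)) refl

    W-vanishes : ∀ j → j < p → W j ≡ 0ℚ
    W-vanishes j j<p = subst (λ j → W j ≡ 0ℚ) (toℕ-fromℕ< j<p)
      (triangular-kernel toℕ toℕ-injective (λ m j → G m (toℕ j))
        (λ m j m<j → G-vanishes m (toℕ j) m<j) (λ m → ι-nonZero (fib-leading (toℕ m)))
        (W ∘ toℕ) W-equations (fromℕ< j<p))

    opposite-injective : Injective _≡_ _≡_ (λ ℓ → p ∸ I ℓ)
    opposite-injective {ℓ} {ℓ′} eq =
      I-injective (ℕ.∸-cancelˡ-≡ (ℕ.<⇒≤ (I<p ℓ)) (ℕ.<⇒≤ (I<p ℓ′)) eq)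

    wPowPair-upper : ∀ ℓ ℓ′ → p ∸ I ℓ < p ∸ I ℓ′ → wPowPair (I ℓ) ℓ′ ≡ 0ℚ
    wPowPair-upper ℓ ℓ′ lt =
      cong₂ (λ a c → ι a + ι c) (wPow-below Iℓ′<Iℓ)
                                (wPow-above {I ℓ} (J-large ℓ′ (I ℓ) Iℓ′<Iℓ (I<p ℓ)))
      where
      Iℓ′<Iℓ : I ℓ′ < I ℓ
      Iℓ′<Iℓ = ℕ.∸-cancelʳ-< lt

    wPowPair-diagonal : ∀ ℓ → wPowPair (I ℓ) ℓ ≢ 0ℚ
    wPowPair-diagonal ℓ = subst (_≢ 0ℚ) (ι-+ (wPow (I ℓ) (I ℓ)) (wPow (I ℓ) (J ℓ)))
      (ι-nonZero (subst (λ a → 1 ≤ a ℕ.+ wPow (I ℓ) (J ℓ)) (sym (wPow-diagonal (I ℓ))) (s≤s z≤n)))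

-- The rows n_ℓ for k = 2K′ + 1

∸-2+∸ : ∀ {a k} → 2 ≤ a → k ∸ (2 ℕ.+ (a ∸ 2)) ≡ k ∸ a
∸-2+∸ {k = k} 2≤a = cong (k ∸_) (ℕ.m+[n∸m]≡n 2≤a)

∸-2+complement : ∀ {a k} → a ≤ k → k ∸ (2 ℕ.+ (k ∸ a)) ≡ a ∸ 2
∸-2+complement {a} {k} a≤k = begin
  k ∸ (2 ℕ.+ (k ∸ a))   ≡⟨ cong (k ∸_) (ℕ.+-comm 2 (k ∸ a)) ⟩
  k ∸ ((k ∸ a) ℕ.+ 2)   ≡⟨ ℕ.∸-+-assoc k (k ∸ a) 2 ⟨
  k ∸ (k ∸ a) ∸ 2       ≡⟨ cong (_∸ 2) (ℕ.m∸[m∸n]≡n a≤k) ⟩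
  a ∸ 2                 ∎
  where open ≡-Reasoning

n≤[n+1]/2*2 : ∀ n → n ≤ (n ℕ.+ 1) / 2 ℕ.* 2
n≤[n+1]/2*2 n = ℕ.≤-pred (begin
  suc n                                   ≡⟨ ℕ.+-comm 1 n ⟩
  n ℕ.+ 1                                 ≡⟨ m≡m%n+[m/n]*n (n ℕ.+ 1) 2 ⟩
  (n ℕ.+ 1) % 2 ℕ.+ (n ℕ.+ 1) / 2 ℕ.* 2   ≤⟨ ℕ.+-monoˡ-≤ _ (ℕ.≤-pred (m%n<n (n ℕ.+ 1) 2)) ⟩
  suc ((n ℕ.+ 1) / 2 ℕ.* 2)               ∎)
  where open ℕ.≤-Reasoning

module RowSelection (K′ : ℕ) (2≤K′ : 2 ≤ K′) where

  k : ℕ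
  k = 2 ℕ.* K′ ℕ.+ 1

  K-k : K k ≡ K′
  K-k = trans (cong (_/ 2) (trans (ℕ.m+n∸n≡m (2 ℕ.* K′) 1) (ℕ.*-comm 2 K′))) (m*n/n≡m K′ 2)

  κ*3≤k : κ k ℕ.* 3 ≤ k
  κ*3≤k = m/n*n≤m k 3

  κ<K′ : κ k < K′
  κ<K′ = m<n*o⇒m/o<n (begin-strict
    2 ℕ.* K′ ℕ.+ 1   <⟨ ℕ.+-monoʳ-< (2 ℕ.* K′) 2≤K′ ⟩
    2 ℕ.* K′ ℕ.+ K′  ≡⟨ 2n+n≡n*3 K′ ⟩
    K′ ℕ.* 3         ∎)
    where
    open ℕ.≤-Reasoning
    2n+n≡n*3 : ∀ n → 2 ℕ.* n ℕ.+ n ≡ n ℕ.* 3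
    2n+n≡n*3 = solve-∀

  κ≤K′ : κ k ≤ K′
  κ≤K′ = ℕ.<⇒≤ κ<K′

  h : ℕ
  h = (κ k ℕ.+ 1) / 2

  L : Fin (κ k) → ℕ
  L ℓ = suc (toℕ ℓ)

  row : Fin (κ k) → ℕ
  row ℓ = nIdx k (L ℓ)

  -- I ℓ is the smaller of the offsets 2n_ℓ − 2 and k − 2n_ℓ, J ℓ the larger.  Both
  -- row-if (the body of nIdx) and I-if branch on the same test, so rowCase evaluates them together.
  row-if I-if : Fin (κ k) → Bool → ℕ
  row-if ℓ upper? = if upper? then L ℓ else L ℓ ℕ.+ K k ∸ κ k
  I-if ℓ upper? = if upper? then 2 ℕ.* toℕ ℓ else suc (2 ℕ.* (κ k ∸ L ℓ))

  I J : Fin (κ k) → ℕ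
  I ℓ = I-if ℓ (L ℓ ≤ᵇ h)
  J ℓ = k ∸ (2 ℕ.+ I ℓ)

  data RowCase (ℓ : Fin (κ k)) : Set where
    upper : L ℓ ≤ h → row ℓ ≡ L ℓ → I ℓ ≡ 2 ℕ.* toℕ ℓ → RowCase ℓ
    lower : h < L ℓ → row ℓ ≡ L ℓ ℕ.+ (K′ ∸ κ k) → I ℓ ≡ suc (2 ℕ.* (κ k ∸ L ℓ)) → RowCase ℓ

  rowCase : ∀ ℓ → RowCase ℓ
  rowCase ℓ with L ℓ ≤ᵇ h in eq
  ... | true = upper (ℕ.≤ᵇ⇒≤ (L ℓ) h (subst T (sym eq) tt)) (cong (row-if ℓ) eq) (cong (I-if ℓ) eq)
  ... | false = lower (ℕ.≰⇒> (λ L≤h → subst T eq (ℕ.≤⇒≤ᵇ L≤h)))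
    (trans (cong (row-if ℓ) eq) (trans (cong (λ K′ → L ℓ ℕ.+ K′ ∸ κ k) K-k) (ℕ.+-∸-assoc (L ℓ) κ≤K′)))
    (cong (I-if ℓ) eq)

  L≤κ : ∀ ℓ → L ℓ ≤ κ k
  L≤κ ℓ = toℕ<n ℓ

  row-bounds : ∀ ℓ → 1 ≤ row ℓ × row ℓ ≤ K′
  row-bounds ℓ with rowCase ℓ
  ... | upper _ row≡L _ = subst (λ n → 1 ≤ n × n ≤ K′) (sym row≡L) (s≤s z≤n , ℕ.≤-trans (L≤κ ℓ) κ≤K′)
  ... | lower _ row≡L+E _ = subst (λ n → 1 ≤ n × n ≤ K′) (sym row≡L+E)
    (s≤s z≤n , ℕ.≤-trans (ℕ.+-monoˡ-≤ (K′ ∸ κ k) (L≤κ ℓ)) (ℕ.≤-reflexive (ℕ.m+[n∸m]≡n κ≤K′)))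

  upper≢lower : ∀ {a c} → a ≤ h → h < c → a ≢ c ℕ.+ (K′ ∸ κ k)
  upper≢lower a≤h h<c refl = ℕ.<⇒≱ h<c (ℕ.≤-trans (ℕ.m≤m+n _ (K′ ∸ κ k)) a≤h)

  row-injective : Injective _≡_ _≡_ row
  row-injective {ℓ} {ℓ′} eq with rowCase ℓ | rowCase ℓ′
  ... | upper _ e _ | upper _ e′ _ = toℕ-injective (ℕ.suc-injective (trans (sym e) (trans eq e′)))
  ... | lower _ e _ | lower _ e′ _ =
    toℕ-injective (ℕ.suc-injective (ℕ.+-cancelʳ-≡ _ (L ℓ) (L ℓ′) (trans (sym e) (trans eq e′))))
  ... | upper L≤h e _ | lower h<L′ e′ _ =
    contradiction (trans (sym e) (trans eq e′)) (upper≢lower L≤h h<L′)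
  ... | lower h<L e _ | upper L′≤h e′ _ =
    contradiction (trans (sym e′) (trans (sym eq) e)) (upper≢lower L′≤h h<L)

  I<κ : ∀ ℓ → I ℓ < κ k
  I<κ ℓ with rowCase ℓ
  ... | upper L≤h _ I≡2x = subst (_< κ k) (sym I≡2x) (ℕ.≤-pred (begin
    2 ℕ.+ 2 ℕ.* toℕ ℓ  ≡⟨ ℕ.*-suc 2 (toℕ ℓ) ⟨
    2 ℕ.* L ℓ          ≤⟨ ℕ.*-monoʳ-≤ 2 L≤h ⟩
    2 ℕ.* h            ≡⟨ ℕ.*-comm 2 h ⟩
    h ℕ.* 2            ≤⟨ m/n*n≤m (κ k ℕ.+ 1) 2 ⟩
    κ k ℕ.+ 1          ≡⟨ ℕ.+-comm (κ k) 1 ⟩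
    suc (κ k)          ∎))
    where open ℕ.≤-Reasoning
  ... | lower h<L _ I≡odd = subst (_< κ k) (sym I≡odd) (ℕ.+-cancelˡ-≤ (2 ℕ.* L ℓ) _ _ (begin
    2 ℕ.* L ℓ ℕ.+ (2 ℕ.+ 2 ℕ.* c)   ≡⟨ rearrange₁ (L ℓ) c ⟩
    2 ℕ.+ 2 ℕ.* (c ℕ.+ L ℓ)         ≡⟨ cong (λ z → 2 ℕ.+ 2 ℕ.* z) (ℕ.m∸n+n≡m (L≤κ ℓ)) ⟩
    2 ℕ.+ 2 ℕ.* κ k                 ≡⟨ rearrange₂ (κ k) ⟩
    κ k ℕ.+ (2 ℕ.+ κ k)             ≤⟨ ℕ.+-monoʳ-≤ (κ k) 2+κ≤2L ⟩
    κ k ℕ.+ 2 ℕ.* L ℓ               ≡⟨ ℕ.+-comm (κ k) _ ⟩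
    2 ℕ.* L ℓ ℕ.+ κ k               ∎))
    where
    open ℕ.≤-Reasoning
    c = κ k ∸ L ℓ
    rearrange₁ : ∀ L c → 2 ℕ.* L ℕ.+ (2 ℕ.+ 2 ℕ.* c) ≡ 2 ℕ.+ 2 ℕ.* (c ℕ.+ L)
    rearrange₁ = solve-∀
    rearrange₂ : ∀ n → 2 ℕ.+ 2 ℕ.* n ≡ n ℕ.+ (2 ℕ.+ n)
    rearrange₂ = solve-∀
    2+κ≤2L : 2 ℕ.+ κ k ≤ 2 ℕ.* L ℓ
    2+κ≤2L = begin
      2 ℕ.+ κ k      ≤⟨ ℕ.+-monoʳ-≤ 2 (n≤[n+1]/2*2 (κ k)) ⟩
      2 ℕ.+ h ℕ.* 2  ≡⟨ trans (cong (2 ℕ.+_) (ℕ.*-comm h 2)) (sym (ℕ.*-suc 2 h)) ⟩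
      2 ℕ.* suc h    ≤⟨ ℕ.*-monoʳ-≤ 2 h<L ⟩
      2 ℕ.* L ℓ      ∎

  I-injective : Injective _≡_ _≡_ I
  I-injective {ℓ} {ℓ′} eq with rowCase ℓ | rowCase ℓ′
  ... | upper _ _ e | upper _ _ e′ =
    toℕ-injective (ℕ.*-cancelˡ-≡ (toℕ ℓ) (toℕ ℓ′) 2 (trans (sym e) (trans eq e′)))
  ... | lower _ _ e | lower _ _ e′ =
    toℕ-injective (ℕ.suc-injective (ℕ.∸-cancelˡ-≡ (L≤κ ℓ) (L≤κ ℓ′)
      (ℕ.*-cancelˡ-≡ _ _ 2 (ℕ.suc-injective (trans (sym e) (trans eq e′))))))
  ... | upper _ _ e | lower _ _ e′ =
    contradiction (trans (sym e) (trans eq e′)) (ℕ.even≢odd (toℕ ℓ) (κ k ∸ L ℓ′))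
  ... | lower _ _ e | upper _ _ e′ =
    contradiction (trans (sym e′) (trans (sym eq) e)) (ℕ.even≢odd (toℕ ℓ′) (κ k ∸ L ℓ))

  J-large : ∀ ℓ d → I ℓ < d → d < κ k → 2 ℕ.* d ℕ.+ 1 < J ℓ
  J-large ℓ d I<d d<κ = ℕ.m+n≤o⇒m≤o∸n (suc (2 ℕ.* d ℕ.+ 1)) (begin
    suc (2 ℕ.* d ℕ.+ 1) ℕ.+ (2 ℕ.+ I ℓ)  ≤⟨ ℕ.+-monoʳ-≤ (suc (2 ℕ.* d ℕ.+ 1)) (s≤s I<d) ⟩
    suc (2 ℕ.* d ℕ.+ 1) ℕ.+ suc d        ≡⟨ rearrange d ⟩
    suc d ℕ.* 3                          ≤⟨ ℕ.*-monoˡ-≤ 3 d<κ ⟩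
    κ k ℕ.* 3                            ≤⟨ κ*3≤k ⟩
    k                                    ∎)
    where
    open ℕ.≤-Reasoning
    rearrange : ∀ d → suc (2 ℕ.* d ℕ.+ 1) ℕ.+ suc d ≡ suc d ℕ.* 3
    rearrange = solve-∀

  offsets : ∀ ℓ → (2 ℕ.* row ℓ ∸ 2 ≡ I ℓ × k ∸ 2 ℕ.* row ℓ ≡ J ℓ) ⊎
                  (k ∸ 2 ℕ.* row ℓ ≡ I ℓ × 2 ℕ.* row ℓ ∸ 2 ≡ J ℓ)
  offsets ℓ with rowCase ℓ
  ... | upper _ row≡L I≡2x =
    inj₁ (c≡I , trans (sym (∸-2+∸ (ℕ.*-monoʳ-≤ 2 1≤n))) (cong (λ i → k ∸ (2 ℕ.+ i)) c≡I))
    where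
    1≤n = proj₁ (row-bounds ℓ)
    c≡I : 2 ℕ.* row ℓ ∸ 2 ≡ I ℓ
    c≡I = begin
      2 ℕ.* row ℓ ∸ 2             ≡⟨ cong (λ n → 2 ℕ.* n ∸ 2) row≡L ⟩
      2 ℕ.* suc (toℕ ℓ) ∸ 2       ≡⟨ cong (_∸ 2) (ℕ.*-suc 2 (toℕ ℓ)) ⟩
      2 ℕ.+ 2 ℕ.* toℕ ℓ ∸ 2       ≡⟨ ℕ.m+n∸m≡n 2 (2 ℕ.* toℕ ℓ) ⟩
      2 ℕ.* toℕ ℓ                 ≡⟨ I≡2x ⟨
      I ℓ                         ∎
      where open ≡-Reasoning
  ... | lower _ row≡L+E I≡odd =
    inj₂ (o≡I , trans (sym (∸-2+complement 2n≤k)) (cong (λ i → k ∸ (2 ℕ.+ i)) o≡I))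
    where
    n≤K′ = proj₂ (row-bounds ℓ)
    2n≤k : 2 ℕ.* row ℓ ≤ k
    2n≤k = ℕ.≤-trans (ℕ.*-monoʳ-≤ 2 n≤K′) (ℕ.m≤m+n (2 ℕ.* K′) 1)
    o≡I : k ∸ 2 ℕ.* row ℓ ≡ I ℓ
    o≡I = begin
      k ∸ 2 ℕ.* row ℓ              ≡⟨ odd-∸-even n≤K′ ⟩
      suc (2 ℕ.* (K′ ∸ row ℓ))     ≡⟨ cong (λ z → suc (2 ℕ.* z)) K′∸row≡κ∸L ⟩
      suc (2 ℕ.* (κ k ∸ L ℓ))      ≡⟨ I≡odd ⟨
      I ℓ                          ∎
      where
      open ≡-Reasoning
      K′∸row≡κ∸L : K′ ∸ row ℓ ≡ κ k ∸ L ℓ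
      K′∸row≡κ∸L = begin
        K′ ∸ row ℓ                  ≡⟨ cong (K′ ∸_) (trans row≡L+E (ℕ.+-comm (L ℓ) _)) ⟩
        K′ ∸ ((K′ ∸ κ k) ℕ.+ L ℓ)   ≡⟨ ℕ.∸-+-assoc K′ (K′ ∸ κ k) (L ℓ) ⟨
        K′ ∸ (K′ ∸ κ k) ∸ L ℓ       ≡⟨ cong (_∸ L ℓ) (ℕ.m∸[m∸n]≡n κ≤K′) ⟩
        κ k ∸ L ℓ                   ∎

  entry : ∀ ℓ m → toℚ (b k (row ℓ) (suc m)) ≡
                  fibExpansion (2 ℕ.* suc m) (I ℓ) + fibExpansion (2 ℕ.* suc m) (J ℓ)
  entry ℓ m = trans (b≡fibExpansion K′ (row ℓ) (suc m) (proj₁ (row-bounds ℓ)) (proj₂ (row-bounds ℓ)))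
                    (reorder (offsets ℓ))
    where
    F : ℕ → ℚ
    F = fibExpansion (2 ℕ.* suc m)
    c = 2 ℕ.* row ℓ ∸ 2
    o = k ∸ 2 ℕ.* row ℓ
    reorder : (c ≡ I ℓ × o ≡ J ℓ) ⊎ (o ≡ I ℓ × c ≡ J ℓ) → F c + F o ≡ F (I ℓ) + F (J ℓ)
    reorder (inj₁ (c≡I , o≡J)) = cong₂ (λ x y → F x + F y) c≡I o≡J
    reorder (inj₂ (o≡I , c≡J)) = trans (ℚ.+-comm (F c) (F o)) (cong₂ (λ x y → F x + F y) o≡I c≡J)

  𝒮-independent : RowsIndependent (κ k) (κ k) (𝒮 k)
  𝒮-independent y combination = pairedRows-independent I J I-injective I<κ J-large y λ m → begin
    ∑[ ℓ < κ k ] (y ℓ * (F m (I ℓ) + F m (J ℓ)))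
      ≡⟨ sum-cong-≗ {κ k} (λ ℓ → cong (y ℓ *_) (entry ℓ (toℕ m))) ⟨
    ∑[ ℓ < κ k ] (y ℓ * 𝒮 k ℓ m)                  ≡⟨ Σ≡sum (κ k) _ ⟨
    Σ (κ k) (λ ℓ → y ℓ * 𝒮 k ℓ m)                 ≡⟨ combination m ⟩
    0ℚ                                            ∎
    where
    open ≡-Reasoning
    F : Fin (κ k) → ℕ → ℚ
    F m = fibExpansion (2 ℕ.* suc (toℕ m))

  suc-pred-row : ∀ ℓ → suc (ℕ.pred (row ℓ)) ≡ row ℓ
  suc-pred-row ℓ = ℕ.suc-pred (row ℓ) {{ℕ.>-nonZero (proj₁ (row-bounds ℓ))}}

  σ : Fin (κ k) → Fin (K k)
  σ ℓ = fromℕ< (subst (ℕ.pred (row ℓ) <_) (sym K-k)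
                      (subst (_≤ K′) (sym (suc-pred-row ℓ)) (proj₂ (row-bounds ℓ))))

  suc-σ : ∀ ℓ → suc (toℕ (σ ℓ)) ≡ row ℓ
  suc-σ ℓ = trans (cong suc (toℕ-fromℕ< _)) (suc-pred-row ℓ)

  σ-injective : ∀ i j → σ i ≡ σ j → i ≡ j
  σ-injective i j σi≡σj = row-injective (trans (sym (suc-σ i)) (trans (cong (suc ∘ toℕ) σi≡σj) (suc-σ j)))

  κ≤K-1 : κ k ≤ K k ∸ 1
  κ≤K-1 = subst (λ K → κ k ≤ K ∸ 1) (sym K-k)
                (ℕ.m+n≤o⇒m≤o∸n (κ k) (subst (_≤ K′) (ℕ.+-comm 1 (κ k)) κ<K′))

  𝒞-rows-independent : RowsIndependent (κ k) (K k ∸ 1) (λ i j → 𝒞 k (σ i) j)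
  𝒞-rows-independent = RowsIndependent-extendColumns _ (λ m → inject≤ m κ≤K-1)
    (RowsIndependent-cong
      (λ i m → sym (cong₂ (λ n m → toℚ (b k n (suc m))) (suc-σ i) (toℕ-inject≤ m κ≤K-1)))
      𝒮-independent)

lemma6p4 : (k : ℕ) → 5 ≤ k → (∃ λ j → k ≡ 2 ℕ.* j ℕ.+ 1) →
    RowsIndependent (κ k) (κ k) (𝒮 k) × RankAtLeast (κ k) (K k) (K k ∸ 1) (𝒞 k)
lemma6p4 _ 5≤k (K′ , refl) = 𝒮-independent , σ , σ-injective , 𝒞-rows-independent
  where
  2≤K′ : 2 ≤ K′
  2≤K′ = ℕ.*-cancelˡ-≤ 2 (ℕ.≤-pred (subst (5 ≤_) (ℕ.+-comm (2 ℕ.* K′) 1) 5≤k))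
  open RowSelection K′ 2≤K′
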